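{- For all rays $a=(a_0,a_1)$, $b=(b_0,b_1)$ and every point $c$ with $\mathrm{Bet}(b_1,b_0,c)$ (so that $\bar b=(b_0,c)$ is a ray opposite to $b$), it is not the case that both $a\sim b$ and $a\sim \bar b$.
   Context: Synthetic plane geometry with classical logic. Primitive notions: points, lines (with equality), incidence $A\in x$, a ternary betweenness relation $\mathrm{Bet}(A,B,C)$ ("$B$ strictly between $A$ and $C$"), lengths with a map $(A,B)\mapsto|AB|$. Points are collinear if some line contains all of them. Axioms: (incidence) there is a point; for every point there is a distinct point; every line has a point; for every line $x$ and $A\in x$ there is $B\in x$, $B\neq A$; for every line there is a point not on it; through two distinct points there is a line; if $A\neq B$, $A,B\in x$ and $x\neq y$ then $A\notin y$ or $B\notin y$. (betweenness) if $\mathrm{Bet}(A,B,C)$ then $A\neq C$, $A,B,C$ collinear, $\mathrm{Bet}(C,B,A)$, and not $\mathrm{Bet}(B,A,C)$. (lengths) $|AB|=|CC|$ iff $A=B$; $|AB|=|BA|$. (line–circle) for $O,A,B$ with $A\neq O$ there is $C$ with ($\mathrm{Bet}(A,O,C)$ or $O=C$) and $|OB|=|OC|$. "$A,B$ on opposite sides of line $x$": $A,B\notin x$ and some $O\in x$ has $\mathrm{Bet}(A,O,B)$. (Pasch) if $A,B$ are on opposite sides of $x$ and $C\notin x$, then $A,C$ or $C,B$ are on opposite sides of $x$. Definitions: "$P,Q$ lie on the same half-line from $O$", written $\mathrm{SR}(O,P,Q)$, means $O\neq P$, $O\neq Q$, $O,P,Q$ collinear, and not $\mathrm{Bet}(P,O,Q)$.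 A ray is an ordered pair $a=(a_0,a_1)$ of distinct points (origin $a_0$, directing point $a_1$). Rays $a,b$ have the same direction, $a\sim b$, iff $(a_0=b_0\wedge \mathrm{SR}(a_0,a_1,b_1))$ or $(\mathrm{SR}(a_0,a_1,b_0)\wedge \mathrm{Bet}(a_0,b_0,b_1))$ or $(\mathrm{SR}(b_0,b_1,a_0)\wedge\mathrm{Bet}(b_0,a_0,a_1))$. -}

module Defs where

open import Level using (Level; _⊔_) renaming (suc to lsuc)
open import Data.Product using (Σ; ∃; _×_; _,_)
open import Data.Sum using (_⊎_)
open import Relation.Nullary using (¬_)
open import Relation.Binary.PropositionalEquality using (_≡_; _≢_; refl)

-- Points, lines (with equality = propositional equality), incidence,
-- strict betweenness, lengths |AB|.  The ambient logic is classical,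
-- which we record as an excluded-middle field.
record Geometry : Set₁ where
  field
    Point  : Set
    Line   : Set
    Length : Set
    _∈_    : Point → Line → Set
    Bet    : Point → Point → Point → Set
    len    : Point → Point → Length

    lem : (P : Set) → P ⊎ ¬ P

    ax-point      : Point
    ax-other      : (A : Point) → ∃ λ B → B ≢ A
    ax-line-point : (x : Line) → ∃ λ A → A ∈ x
    ax-line-other : (x : Line) (A : Point) → A ∈ x → ∃ λ B → B ∈ x × B ≢ A
    ax-off-line   : (x : Line) → ∃ λ A → ¬ (A ∈ x)
    ax-line       : (A B : Point) → A ≢ B → ∃ λ x → A ∈ x × B ∈ x
    ax-unique     : (A B : Point) (x y : Line) → A ≢ B → A ∈ x → B ∈ x → x ≢ y →
                    ¬ (A ∈ y) ⊎ ¬ (B ∈ y)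

    bet-neq   : ∀ {A B C} → Bet A B C → A ≢ C
    bet-col   : ∀ {A B C} → Bet A B C → ∃ λ x → A ∈ x × B ∈ x × C ∈ x
    bet-sym   : ∀ {A B C} → Bet A B C → Bet C B A
    bet-not   : ∀ {A B C} → Bet A B C → ¬ Bet B A C

    len-zero  : ∀ A B C → (len A B ≡ len C C → A ≡ B) × (A ≡ B → len A B ≡ len C C)
    len-sym   : ∀ A B → len A B ≡ len B A

    line-circle : ∀ O A B → A ≢ O →
                  ∃ λ C → (Bet A O C ⊎ O ≡ C) × len O B ≡ len O C

  Collinear : Point → Point → Point → Set
  Collinear A B C = ∃ λ x → A ∈ x × B ∈ x × C ∈ x

  Opp : Point → Point → Line → Set
  Opp A B x = ¬ (A ∈ x) × ¬ (B ∈ x) × ∃ λ O → O ∈ x × Bet A O B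

  field
    pasch : ∀ A B C x → Opp A B x → ¬ (C ∈ x) → Opp A C x ⊎ Opp C B x

  SR : Point → Point → Point → Set
  SR O P Q = O ≢ P × O ≢ Q × Collinear O P Q × ¬ Bet P O Q

  Ray : Set
  Ray = Σ (Point × Point) λ { (a₀ , a₁) → a₀ ≢ a₁ }

  origin : Ray → Point
  origin ((a₀ , _) , _) = a₀

  dir : Ray → Point
  dir ((_ , a₁) , _) = a₁

  _∼_ : Ray → Ray → Set
  a ∼ b = (origin a ≡ origin b × SR (origin a) (dir a) (dir b))
        ⊎ (SR (origin a) (dir a) (origin b) × Bet (origin a) (origin b) (dir b))
        ⊎ (SR (origin b) (dir b) (origin a) × Bet (origin b) (origin a) (dir a))

  bet-neq₂ : ∀ {A B C} → Bet A B C → B ≢ C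
  bet-neq₂ h refl = bet-not (bet-sym h) (bet-sym h)

  opposite : (b : Ray) (c : Point) → Bet (dir b) (origin b) c → Ray
  opposite b c h = (origin b , c) , bet-neq₂ h

-- Apart from immediate contradictions, every combination of the cases of a ∼ b
-- and a ∼ b̄ ends in one of two facts about the line b₁b₀c: points on the same
-- half-line from O as a common point are not separated by O, and O cannot
-- separate all three pairs among three points.  The first is Pasch's axiom
-- applied to a second line through O; the second needs in addition that of three
-- collinear points one lies between the others, which is proved by the classical
-- auxiliary-triangle argument.
module Submission where

open import Defs
open import Data.Product using (_×_; ∃; _,_; proj₁)
open import Data.Sum using (_⊎_; inj₁; inj₂)
open import Data.Empty using (⊥; ⊥-elim)
open import Function using (_∘_)
open import Relation.Nullary using (¬_)
open import Relation.Binary.PropositionalEquality using (_≡_; _≢_; refl; sym; ≢-sym; subst)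

module Ordering (G : Geometry) where
  open Geometry G

  line-unique : ∀ {A B x y} → A ≢ B → A ∈ x → B ∈ x → A ∈ y → B ∈ y → x ≡ y
  line-unique {A} {B} {x} {y} A≢B Ax Bx Ay By with lem (x ≡ y)
  ... | inj₁ x≡y = x≡y
  ... | inj₂ x≢y with ax-unique A B x y A≢B Ax Bx x≢y
  ...   | inj₁ A∉y = ⊥-elim (A∉y Ay)
  ...   | inj₂ B∉y = ⊥-elim (B∉y By)

  ∈-transfer : ∀ {A B C x y} → A ≢ B → A ∈ x → B ∈ x → A ∈ y → B ∈ y → C ∈ x → C ∈ y
  ∈-transfer A≢B Ax Bx Ay By = subst (_ ∈_) (line-unique A≢B Ax Bx Ay By)

  ∉-other : ∀ {O X ℓ m} → ℓ ≢ m → O ∈ ℓ → O ∈ m → X ∈ ℓ → X ≢ O → ¬ X ∈ m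
  ∉-other ℓ≢m Oℓ Om Xℓ X≢O Xm = ℓ≢m (line-unique X≢O Xℓ Oℓ Xm Om)

  other-line-through : ∀ {O ℓ} → O ∈ ℓ → ∃ λ m → O ∈ m × ℓ ≢ m
  other-line-through {O} {ℓ} Oℓ with ax-off-line ℓ
  ... | Q , Q∉ℓ with ax-line O Q (λ { refl → Q∉ℓ Oℓ })
  ...   | m , Om , Qm = m , Om , λ { refl → Q∉ℓ Qm }

  bet-neq₁ : ∀ {A B C} → Bet A B C → A ≢ B
  bet-neq₁ ABC = ≢-sym (bet-neq₂ (bet-sym ABC))

  bet-∈-middle : ∀ {A B C x} → Bet A B C → A ∈ x → C ∈ x → B ∈ x
  bet-∈-middle ABC Ax Cx with bet-col ABC
  ... | y , Ay , By , Cy = ∈-transfer (bet-neq ABC) Ay Cy Ax Cx By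

  bet-∈-end : ∀ {A B C x} → Bet A B C → B ∈ x → C ∈ x → A ∈ x
  bet-∈-end ABC Bx Cx with bet-col ABC
  ... | y , Ay , By , Cy = ∈-transfer (bet-neq₂ ABC) By Cy Bx Cx Ay

  bet-extend : ∀ {A O} → A ≢ O → ∃ λ C → Bet A O C
  bet-extend {A} {O} A≢O with line-circle O A A A≢O
  ... | C , inj₁ AOC , _ = C , AOC
  ... | C , inj₂ refl , |OA|≡|OO| = ⊥-elim (A≢O (sym (proj₁ (len-zero O A O) |OA|≡|OO|)))

  crossing : ∀ {O Y P ℓ m} → ℓ ≢ m → O ∈ ℓ → O ∈ m → Y ∈ ℓ → P ∈ ℓ → Opp Y P m → Bet Y O P
  crossing {O} ℓ≢m Oℓ Om Yℓ Pℓ (_ , _ , R , Rm , YRP) with lem (R ≡ O)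
  ... | inj₁ refl = YRP
  ... | inj₂ R≢O = ⊥-elim (∉-other ℓ≢m Oℓ Om (bet-∈-middle YRP Yℓ Pℓ) R≢O Rm)

  -- A second line through O separates ℓ, and Pasch makes the separation transitive.
  ¬Bet-trans : ∀ {O P Y Z ℓ} → O ∈ ℓ → P ∈ ℓ → Y ∈ ℓ → Z ∈ ℓ → P ≢ O →
               ¬ Bet P O Y → ¬ Bet P O Z → ¬ Bet Y O Z
  ¬Bet-trans {O} {P} {Y} {Z} {ℓ} Oℓ Pℓ Yℓ Zℓ P≢O ¬POY ¬POZ YOZ with other-line-through Oℓ
  ... | m , Om , ℓ≢m =
    separate (pasch Y Z P m (off Yℓ (bet-neq₁ YOZ) , off Zℓ (≢-sym (bet-neq₂ YOZ)) , O , Om , YOZ) (off Pℓ P≢O))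
    where
    off : ∀ {X} → X ∈ ℓ → X ≢ O → ¬ X ∈ m
    off = ∉-other ℓ≢m Oℓ Om
    separate : Opp Y P m ⊎ Opp P Z m → ⊥
    separate (inj₁ YP) = ¬POY (bet-sym (crossing ℓ≢m Oℓ Om Yℓ Pℓ YP))
    separate (inj₂ PZ) = ¬POZ (crossing ℓ≢m Oℓ Om Pℓ Zℓ PZ)

  segment-crossing : ∀ {A B C D G ℓ p} → A ∈ ℓ → B ∈ ℓ → C ∈ ℓ → ¬ D ∈ ℓ → B ≢ A → C ≢ A →
                     A ∈ p → D ∈ p → Bet B D G → ¬ Bet B A C → ∃ λ E → E ∈ p × Bet C E G
  segment-crossing {B = B} {C} {D} {G} {ℓ} {p} Aℓ Bℓ Cℓ D∉ℓ B≢A C≢A Ap Dp BDG ¬BAC =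
    cross (pasch B G C p (B∉p , B∉p ∘ bet-∈-end BDG Dp , D , Dp , BDG) (∉-other ℓ≢p Aℓ Ap Cℓ C≢A))
    where
    ℓ≢p : ℓ ≢ p
    ℓ≢p refl = D∉ℓ Dp
    B∉p : ¬ B ∈ p
    B∉p = ∉-other ℓ≢p Aℓ Ap Bℓ B≢A
    cross : Opp B C p ⊎ Opp C G p → ∃ λ E → E ∈ p × Bet C E G
    cross (inj₁ BC) = ⊥-elim (¬BAC (crossing ℓ≢p Aℓ Ap Bℓ Cℓ BC))
    cross (inj₂ (_ , _ , E , Ep , CEG)) = E , Ep , CEG

  -- AE and CF are cevians of the triangle ACG through D, so they cross inside it.
  cevians-meet-inside : ∀ {A C D E F G p q} → A ∈ p → D ∈ p → E ∈ p → C ∈ q → D ∈ q → F ∈ q →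
                        ¬ A ∈ q → ¬ G ∈ q → Bet A F G → Bet C E G → Bet A D E
  cevians-meet-inside {A} {D = D} {E} {F} {G} {p} {q} Ap Dp Ep Cq Dq Fq A∉q G∉q AFG CEG with bet-col CEG
  ... | r , Cr , Er , Gr = cross (pasch A G E q (A∉q , G∉q , F , Fq , AFG) E∉q)
    where
    E∉q : ¬ E ∈ q
    E∉q Eq = G∉q (bet-∈-end (bet-sym CEG) Eq Cq)
    p≢q : p ≢ q
    p≢q refl = A∉q Ap
    r≢q : r ≢ q
    r≢q refl = G∉q Gr
    cross : Opp A E q ⊎ Opp E G q → Bet A D E
    cross (inj₁ AE) = crossing p≢q Dp Dq Ap Ep AE
    cross (inj₂ EG) = ⊥-elim (bet-not CEG (crossing r≢q Cr Cq Er Gr EG))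

  -- Hilbert's argument: D off ℓ, G beyond D from B, and E, F where AD, CD cross CG, AG.
  some-between : ∀ {A B C ℓ} → A ∈ ℓ → B ∈ ℓ → C ∈ ℓ → A ≢ B → B ≢ C → A ≢ C →
                 ¬ Bet B A C → ¬ Bet A C B → Bet A B C
  some-between {A} {B} {C} {ℓ} Aℓ Bℓ Cℓ A≢B B≢C A≢C ¬BAC ¬ACB with ax-off-line ℓ
  ... | D , D∉ℓ with bet-extend {B} {D} (λ { refl → D∉ℓ Bℓ })
  ... | G , BDG with bet-col BDG | ax-line A D (λ { refl → D∉ℓ Aℓ }) | ax-line C D (λ { refl → D∉ℓ Cℓ })
  ... | s , Bs , Ds , Gs | p , Ap , Dp | q , Cq , Dq
    with segment-crossing Aℓ Bℓ Cℓ D∉ℓ (≢-sym A≢B) (≢-sym A≢C) Ap Dp BDG ¬BAC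
       | segment-crossing Cℓ Bℓ Aℓ D∉ℓ B≢C A≢C Cq Dq BDG (¬ACB ∘ bet-sym)
  ... | E , Ep , CEG | F , Fq , AFG with bet-col CEG
  ... | r , Cr , Er , Gr = cross (pasch A E C s (off-s Aℓ A≢B , E∉s , D , Ds , ADE) (off-s Cℓ (≢-sym B≢C)))
    where
    ℓ≢s : ℓ ≢ s
    ℓ≢s refl = D∉ℓ Ds
    ℓ≢q : ℓ ≢ q
    ℓ≢q refl = D∉ℓ Dq
    off-s : ∀ {X} → X ∈ ℓ → X ≢ B → ¬ X ∈ s
    off-s = ∉-other ℓ≢s Bℓ Bs
    ADE : Bet A D E
    ADE = cevians-meet-inside Ap Dp Ep Cq Dq Fq (∉-other ℓ≢q Cℓ Cq Aℓ A≢C)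
            (∉-other ℓ≢q Cℓ Cq Bℓ B≢C ∘ bet-∈-end BDG Dq) AFG CEG
    E∉s : ¬ E ∈ s
    E∉s = off-s Aℓ A≢B ∘ bet-∈-end ADE Ds
    r≢s : r ≢ s
    r≢s refl = off-s Cℓ (≢-sym B≢C) Cr
    cross : Opp A C s ⊎ Opp C E s → Bet A B C
    cross (inj₁ AC) = crossing ℓ≢s Bℓ Bs Aℓ Cℓ AC
    cross (inj₂ CE) = ⊥-elim (bet-not (bet-sym CEG) (bet-sym (crossing r≢s Gr Gs Cr Er CE)))

  -- Otherwise some-between puts Y between X and Z, although both lie on the side of O from Y.
  Bet∧Bet⇒¬Bet : ∀ {O X Y Z} → Bet X O Y → Bet X O Z → ¬ Bet Y O Z
  Bet∧Bet⇒¬Bet {X = X} {Y} {Z} XOY XOZ YOZ with bet-col XOY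
  ... | ℓ , Xℓ , Oℓ , Yℓ = ¬Bet-trans Yℓ Oℓ Xℓ Zℓ (bet-neq₂ XOY) (bet-not (bet-sym XOY)) (bet-not YOZ) XYZ
    where
    Zℓ : Z ∈ ℓ
    Zℓ = bet-∈-end (bet-sym XOZ) Oℓ Xℓ
    XYZ : Bet X Y Z
    XYZ = some-between Xℓ Yℓ Zℓ (bet-neq XOY) (bet-neq YOZ) (bet-neq XOZ)
            (¬Bet-trans Xℓ Oℓ Yℓ Zℓ (≢-sym (bet-neq₁ XOY)) (bet-not XOY) (bet-not XOZ))
            (¬Bet-trans Zℓ Oℓ Xℓ Yℓ (bet-neq₂ XOZ) (bet-not (bet-sym XOZ)) (bet-not (bet-sym YOZ)))

  SR-sym : ∀ {O P Q} → SR O P Q → SR O Q P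
  SR-sym (O≢P , O≢Q , (x , Ox , Px , Qx) , ¬POQ) = O≢Q , O≢P , (x , Ox , Qx , Px) , ¬POQ ∘ bet-sym

  SR∧SR⇒¬Bet : ∀ {O P Y Z} → SR O P Y → SR O P Z → ¬ Bet Y O Z
  SR∧SR⇒¬Bet (O≢P , _ , (ℓ , Oℓ , Pℓ , Yℓ) , ¬POY) (_ , _ , (m , Om , Pm , Zm) , ¬POZ) =
    ¬Bet-trans Oℓ Pℓ Yℓ (∈-transfer O≢P Om Pm Oℓ Pℓ Zm) (≢-sym O≢P) ¬POY ¬POZ

theorem9 : (G : Geometry) → let open Geometry G in
    (a b : Ray) (c : Point) (h : Bet (dir b) (origin b) c) →
    ¬ (a ∼ b × a ∼ opposite b c h)
theorem9 G ((a₀ , a₁) , _) ((b₀ , b₁) , _) c h = λ where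
    (inj₁ (refl , sr₁) , inj₁ (_ , sr₂)) → SR∧SR⇒¬Bet sr₁ sr₂ h
    (inj₁ (refl , _) , inj₂ (inj₁ (_ , b₀b₀c))) → bet-neq₁ b₀b₀c refl
    (inj₁ (refl , _) , inj₂ (inj₂ ((_ , b₀≢b₀ , _) , _))) → b₀≢b₀ refl
    (inj₂ (inj₁ (_ , a₀a₀b₁)) , inj₁ (refl , _)) → bet-neq₁ a₀a₀b₁ refl
    (inj₂ (inj₂ ((_ , b₀≢b₀ , _) , _)) , inj₁ (refl , _)) → b₀≢b₀ refl
    (inj₂ (inj₁ (_ , a₀b₀b₁)) , inj₂ (inj₁ (_ , a₀b₀c))) → Bet∧Bet⇒¬Bet a₀b₀b₁ a₀b₀c h
    (inj₂ (inj₁ ((_ , _ , _ , ¬a₁a₀b₀) , _)) , inj₂ (inj₂ (_ , b₀a₀a₁))) → ¬a₁a₀b₀ (bet-sym b₀a₀a₁)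
    (inj₂ (inj₂ (_ , b₀a₀a₁)) , inj₂ (inj₁ ((_ , _ , _ , ¬a₁a₀b₀) , _))) → ¬a₁a₀b₀ (bet-sym b₀a₀a₁)
    (inj₂ (inj₂ (sr₁ , _)) , inj₂ (inj₂ (sr₂ , _))) → SR∧SR⇒¬Bet (SR-sym sr₁) (SR-sym sr₂) h
  where
  open Geometry G using (bet-sym)
  open Ordering G
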